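{- Cycle $\mathbb{C}_n,n\geq 3$ is a compliant graph and $$d_{td}(a_i)=\begin{cases} \frac{n}{2} \quad &\text{ if } n\equiv 0 (mod4)\\ \frac{n+1}{2} \quad &\text{ if } n\equiv 1,3 (mod 4)\\ \frac{n}{2}+1 \quad &\text{ if } n\equiv 2 (mod 4) \end{cases}$$
   Context: For a graph without isolated vertices, a total dominating set (TDS) is a set $S$ of vertices such that every vertex is adjacent to some vertex of $S$; a minimal TDS (MTDS) is a TDS no proper subset of which is a TDS. A vertex is compliant if some MTDS contains it; a graph is compliant if all its vertices are compliant. For a vertex $a$ of a compliant graph, the total domination degree is $d_{td}(a)=\min\{|S| : S \text{ is an MTDS containing } a\}$. The cycle $\mathbb{C}_n$ has vertices $a_1,\dots,a_n$. -}

module Defs where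

open import Data.Nat using (ℕ; zero; suc; _+_; _≤_; NonZero)
open import Data.Nat.DivMod using (_%_; _/_)
open import Data.Fin using (Fin; toℕ)
open import Data.Fin.Subset using (Subset; _∈_; _⊆_; ∣_∣)
open import Data.Sum using (_⊎_)
open import Data.Product using (Σ; _×_; ∃)
open import Relation.Binary.PropositionalEquality using (_≡_)
open import Relation.Nullary using (¬_)

Graph : ℕ → Set₁
Graph n = Fin n → Fin n → Set

IsTDS : ∀ {n} → Graph n → Subset n → Set
IsTDS {n} G S = (v : Fin n) → ∃ λ u → u ∈ S × G v u

IsMTDS : ∀ {n} → Graph n → Subset n → Set
IsMTDS G S = IsTDS G S × (∀ T → T ⊆ S → ¬ (T ≡ S) → ¬ IsTDS G T)

Compliant : ∀ {n} → Graph n → Fin n → Set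
Compliant G a = ∃ λ S → IsMTDS G S × a ∈ S

CompliantGraph : ∀ {n} → Graph n → Set
CompliantGraph {n} G = (a : Fin n) → Compliant G a

TotalDomDegree : ∀ {n} → Graph n → Fin n → ℕ → Set
TotalDomDegree G a k =
  (∃ λ S → IsMTDS G S × a ∈ S × ∣ S ∣ ≡ k)
  × (∀ S → IsMTDS G S → a ∈ S → k ≤ ∣ S ∣)

-- The cycle C_n: vertex i (0-based, i.e. a_{i+1}) is adjacent to i+1 and i-1 mod n.
-- SuccMod n i j : j ≡ i + 1 (mod n), for vertices in Fin n.
SuccMod : (n : ℕ) → Fin n → Fin n → Set
SuccMod n i j = (toℕ i + 1 ≡ toℕ j) ⊎ (toℕ i + 1 ≡ n × toℕ j ≡ 0)

CycleAdj : (n : ℕ) → Graph n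
CycleAdj n i j = SuccMod n i j ⊎ SuccMod n j i

cycleTDDeg : ℕ → ℕ
cycleTDDeg n with n % 4
... | 0 = n / 2
... | 2 = n / 2 + 1
... | _ = (n + 1) / 2

{-# OPTIONS --safe #-}
-- S totally dominates Cₙ iff [aᵢ₋₁ ∈ S] + [aᵢ₊₁ ∈ S] ≥ 1 for every i.
-- Summing over i counts S twice, so |S| ≥ ⌈n/2⌉. For n = 2m the even vertices
-- are dominated only by odd ones and vice versa, and each half behaves like a
-- cycle of length m, so |S| ≥ 2⌈m/2⌉. In every case this bound is cycleTDDeg n,
-- and it is attained by the pattern 1100 1100 … rotated to contain any given
-- vertex. A TDS of minimum size has no proper sub-TDS, so it is an MTDS; hence
-- Cₙ is compliant and d_td(a) = cycleTDDeg n for every a.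
module Submission where

open import Defs
open import Data.Nat using (ℕ; _≤_)
open import Data.Fin using (Fin)
open import Data.Product using (_×_)

open import Data.Bool using (Bool; true; false)
open import Data.Fin using (toℕ; fromℕ<; zero; suc)
open import Data.Fin.Properties using (toℕ<n; toℕ-fromℕ<)
open import Data.Fin.Subset using (Subset; inside; outside; _∈_; _⊆_; ∣_∣)
open import Data.Fin.Subset.Properties using (p⊆q⇒∣p∣≤∣q∣; drop-∷-⊆)
open import Data.Nat using (zero; suc; pred; _+_; _<_; _≟_; ⌈_/2⌉; z≤n; s≤s)
open import Data.Nat.DivMod using (_%_; _/_; m/n≡1+[m∸n]/n)
open import Data.Nat.Properties
open import Algebra.Properties.CommutativeSemigroup +-commutativeSemigroup using (interchange)
open import Data.Nat.Tactic.RingSolver using (solve-∀)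
open import Data.Product using (∃; _,_; proj₁)
open import Data.Sum using (_⊎_; inj₁; inj₂)
open import Data.Vec using ([]; _∷_; tabulate)
open import Data.Vec.Base using (here; there)
open import Function using (_∘_; id)
open import Relation.Binary.PropositionalEquality
open import Relation.Nullary using (¬_; yes; no; contradiction)

∑< : ℕ → (ℕ → ℕ) → ℕ
∑< zero    f = 0
∑< (suc n) f = ∑< n f + f n

∑<-cong : ∀ n {f g : ℕ → ℕ} → (∀ i → i < n → f i ≡ g i) → ∑< n f ≡ ∑< n g
∑<-cong zero    f≗g = refl
∑<-cong (suc n) f≗g = cong₂ _+_ (∑<-cong n (λ i i<n → f≗g i (m<n⇒m<1+n i<n))) (f≗g n ≤-refl)

∑<-mono-≤ : ∀ n {f g : ℕ → ℕ} → (∀ i → i < n → f i ≤ g i) → ∑< n f ≤ ∑< n g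
∑<-mono-≤ zero    f≤g = z≤n
∑<-mono-≤ (suc n) f≤g = +-mono-≤ (∑<-mono-≤ n (λ i i<n → f≤g i (m<n⇒m<1+n i<n))) (f≤g n ≤-refl)

∑<-distrib-+ : ∀ n (f g : ℕ → ℕ) → ∑< n (λ i → f i + g i) ≡ ∑< n f + ∑< n g
∑<-distrib-+ zero    f g = refl
∑<-distrib-+ (suc n) f g =
  trans (cong (_+ (f n + g n)) (∑<-distrib-+ n f g)) (interchange (∑< n f) (∑< n g) (f n) (g n))

∑<-1 : ∀ n → ∑< n (λ _ → 1) ≡ n
∑<-1 zero    = refl
∑<-1 (suc n) = trans (cong (_+ 1) (∑<-1 n)) (+-comm n 1)

∑<-+ : ∀ k n (f : ℕ → ℕ) → ∑< (k + n) f ≡ ∑< k f + ∑< n (λ i → f (k + i))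
∑<-+ k zero    f rewrite +-identityʳ k = sym (+-identityʳ (∑< k f))
∑<-+ k (suc n) f rewrite +-suc k n =
  trans (cong (_+ f (k + n)) (∑<-+ k n f)) (+-assoc (∑< k f) _ (f (k + n)))

∑<-evens+odds : ∀ m (f : ℕ → ℕ) →
                ∑< (m + m) f ≡ ∑< m (λ k → f (k + k)) + ∑< m (λ k → f (suc (k + k)))
∑<-evens+odds zero    f = refl
∑<-evens+odds (suc m) f rewrite +-suc m m = begin
    ∑< (m + m) f + f (m + m) + f (suc (m + m))
  ≡⟨ +-assoc (∑< (m + m) f) _ _ ⟩
    ∑< (m + m) f + (f (m + m) + f (suc (m + m)))
  ≡⟨ cong (_+ (f (m + m) + f (suc (m + m)))) (∑<-evens+odds m f) ⟩
    ∑< m (λ k → f (k + k)) + ∑< m (λ k → f (suc (k + k))) + (f (m + m) + f (suc (m + m)))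
  ≡⟨ interchange (∑< m (λ k → f (k + k))) _ _ _ ⟩
    ∑< m (λ k → f (k + k)) + f (m + m) + (∑< m (λ k → f (suc (k + k))) + f (suc (m + m)))
  ∎
  where open ≡-Reasoning

next : ℕ → ℕ → ℕ
next n k with suc k ≟ n
... | yes _ = 0
... | no  _ = suc k

prev : ℕ → ℕ → ℕ
prev n zero    = pred n
prev n (suc k) = k

next-last : ∀ {n k} → suc k ≡ n → next n k ≡ 0
next-last {n} {k} 1+k≡n with suc k ≟ n
... | yes _     = refl
... | no  1+k≢n = contradiction 1+k≡n 1+k≢n

next-nonlast : ∀ {n k} → ¬ suc k ≡ n → next n k ≡ suc k
next-nonlast {n} {k} 1+k≢n with suc k ≟ n
... | yes 1+k≡n = contradiction 1+k≡n 1+k≢n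
... | no  _     = refl

next< : ∀ {n k} → k < n → next n k < n
next< {n} {k} k<n with suc k ≟ n
... | yes _     = ≤-trans (s≤s z≤n) k<n
... | no  1+k≢n = ≤∧≢⇒< k<n 1+k≢n

prev< : ∀ {n k} → k < n → prev n k < n
prev< {suc n} {zero}  _   = ≤-refl
prev< {n}     {suc k} k<n = <-trans (n<1+n k) k<n

prev-next : ∀ {n k} → k < n → prev n (next n k) ≡ k
prev-next {n} {k} _ with suc k ≟ n
... | yes refl = refl
... | no  _    = refl

next-prev : ∀ {n k} → k < n → next n (prev n k) ≡ k
next-prev {suc n} {zero}  _   = next-last refl
next-prev {n}     {suc k} k<n = next-nonlast (<⇒≢ k<n)

∑<-next : ∀ n (f : ℕ → ℕ) → ∑< n (f ∘ next n) ≡ ∑< n f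
∑<-next zero    f = refl
∑<-next (suc n) f = begin
    ∑< n (f ∘ next (suc n)) + f (next (suc n) n)
  ≡⟨ cong₂ _+_ (∑<-cong n (λ i i<n → cong f (next-nonlast (<⇒≢ (s≤s i<n)))))
               (cong f (next-last refl)) ⟩
    ∑< n (f ∘ suc) + f 0
  ≡⟨ +-comm _ (f 0) ⟩
    f 0 + ∑< n (f ∘ suc)
  ≡⟨ sym (∑<-+ 1 n f) ⟩
    ∑< (suc n) f
  ∎
  where open ≡-Reasoning

∑<-prev : ∀ n (f : ℕ → ℕ) → ∑< n (f ∘ prev n) ≡ ∑< n f
∑<-prev n f = begin
    ∑< n (f ∘ prev n)
  ≡⟨ sym (∑<-next n (f ∘ prev n)) ⟩
    ∑< n (f ∘ prev n ∘ next n)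
  ≡⟨ ∑<-cong n (λ i i<n → cong f (prev-next i<n)) ⟩
    ∑< n f
  ∎
  where open ≡-Reasoning

next-double-suc : ∀ {m k} → k < m → next (m + m) (suc (k + k)) ≡ next m k + next m k
next-double-suc {m} {k} k<m with suc k ≟ m
... | yes refl = next-last (cong suc (sym (+-suc k k)))
... | no  1+k≢m = trans (next-nonlast (<⇒≢ 2+2k<m+m)) (cong suc (sym (+-suc k k)))
  where
  2+2k<m+m : suc (suc (k + k)) < m + m
  2+2k<m+m = subst (_< m + m) (cong suc (+-suc k k))
                   (+-mono-< (≤∧≢⇒< k<m 1+k≢m) (≤∧≢⇒< k<m 1+k≢m))

k<m⇒1+[k+k]<m+m : ∀ {m k} → k < m → suc (k + k) < m + m
k<m⇒1+[k+k]<m+m {m} {k} k<m = subst (_≤ m + m) (cong suc (+-suc k k)) (+-mono-≤ k<m k<m)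

next-double : ∀ {m k} → k < m → next (m + m) (k + k) ≡ suc (k + k)
next-double k<m = next-nonlast (<⇒≢ (k<m⇒1+[k+k]<m+m k<m))

prev-double : ∀ {m k} → k < m → prev (m + m) (k + k) ≡ suc (prev m k + prev m k)
prev-double {suc m} {zero}  _ = +-suc m m
prev-double {m}     {suc k} _ = +-suc k k

m≤n+n⇒⌈m/2⌉≤n : ∀ {m n} → m ≤ n + n → ⌈ m /2⌉ ≤ n
m≤n+n⇒⌈m/2⌉≤n {m} {n} m≤n+n = ≤-trans (⌈n/2⌉-mono m≤n+n) (≤-reflexive (sym (n≡⌈n+n/2⌉ n)))

double-counting : ∀ m (f g h : ℕ → ℕ) → ∑< m (f ∘ g) ≡ ∑< m f → ∑< m (f ∘ h) ≡ ∑< m f →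
                  (∀ k → k < m → 1 ≤ f (g k) + f (h k)) → ⌈ m /2⌉ ≤ ∑< m f
double-counting m f g h ∑fg≡∑f ∑fh≡∑f covered = m≤n+n⇒⌈m/2⌉≤n (begin
    m
  ≡⟨ sym (∑<-1 m) ⟩
    ∑< m (λ _ → 1)
  ≤⟨ ∑<-mono-≤ m covered ⟩
    ∑< m (λ k → f (g k) + f (h k))
  ≡⟨ ∑<-distrib-+ m (f ∘ g) (f ∘ h) ⟩
    ∑< m (f ∘ g) + ∑< m (f ∘ h)
  ≡⟨ cong₂ _+_ ∑fg≡∑f ∑fh≡∑f ⟩
    ∑< m f + ∑< m f
  ∎)
  where open ≤-Reasoning

bit : Bool → ℕ
bit true  = 1
bit false = 0

𝟙 : ∀ {n} → Subset n → ℕ → ℕ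
𝟙 []      _       = 0
𝟙 (b ∷ p) zero    = bit b
𝟙 (b ∷ p) (suc i) = 𝟙 p i

∣p∣≡∑<𝟙 : ∀ {n} (p : Subset n) → ∣ p ∣ ≡ ∑< n (𝟙 p)
∣p∣≡∑<𝟙 []                  = refl
∣p∣≡∑<𝟙 {suc n} (inside ∷ p)  = trans (cong suc (∣p∣≡∑<𝟙 p)) (sym (∑<-+ 1 n (𝟙 (inside ∷ p))))
∣p∣≡∑<𝟙 {suc n} (outside ∷ p) = trans (∣p∣≡∑<𝟙 p) (sym (∑<-+ 1 n (𝟙 (outside ∷ p))))

x∈p⇒1≤𝟙 : ∀ {n} {p : Subset n} {x i} → x ∈ p → toℕ x ≡ i → 1 ≤ 𝟙 p i
x∈p⇒1≤𝟙 here        refl = ≤-refl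
x∈p⇒1≤𝟙 (there x∈p) refl = x∈p⇒1≤𝟙 x∈p refl

p⊆q∧p≢q⇒∣p∣<∣q∣ : ∀ {n} {p q : Subset n} → p ⊆ q → ¬ p ≡ q → ∣ p ∣ < ∣ q ∣
p⊆q∧p≢q⇒∣p∣<∣q∣ {p = []}          {[]}          _   p≢q = contradiction refl p≢q
p⊆q∧p≢q⇒∣p∣<∣q∣ {p = inside ∷ p}  {outside ∷ q} p⊆q _   with p⊆q here
... | ()
p⊆q∧p≢q⇒∣p∣<∣q∣ {p = outside ∷ p} {inside ∷ q}  p⊆q _   = s≤s (p⊆q⇒∣p∣≤∣q∣ (drop-∷-⊆ p⊆q))
p⊆q∧p≢q⇒∣p∣<∣q∣ {p = inside ∷ p}  {inside ∷ q}  p⊆q p≢q =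
  s≤s (p⊆q∧p≢q⇒∣p∣<∣q∣ (drop-∷-⊆ p⊆q) (p≢q ∘ cong (inside ∷_)))
p⊆q∧p≢q⇒∣p∣<∣q∣ {p = outside ∷ p} {outside ∷ q} p⊆q p≢q =
  p⊆q∧p≢q⇒∣p∣<∣q∣ (drop-∷-⊆ p⊆q) (p≢q ∘ cong (outside ∷_))

module _ {n} (G : Graph n) where

  minimum-TDS⇒IsMTDS : ∀ {S} → IsTDS G S → (∀ T → IsTDS G T → ∣ S ∣ ≤ ∣ T ∣) → IsMTDS G S
  minimum-TDS⇒IsMTDS tds minimum =
    tds , λ T T⊆S T≢S tdsT → <⇒≱ (p⊆q∧p≢q⇒∣p∣<∣q∣ T⊆S T≢S) (minimum T tdsT)

  minimum-TDS∋⇒TotalDomDegree : ∀ k → (∀ T → IsTDS G T → k ≤ ∣ T ∣) →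
                                ∀ {a} → (∃ λ S → IsTDS G S × a ∈ S × ∣ S ∣ ≡ k) →
                                TotalDomDegree G a k
  minimum-TDS∋⇒TotalDomDegree k k≤∣TDS∣ (S , tds , a∈S , ∣S∣≡k) =
    (S , minimum-TDS⇒IsMTDS tds (λ T → subst (_≤ ∣ T ∣) (sym ∣S∣≡k) ∘ k≤∣TDS∣ T) , a∈S , ∣S∣≡k) ,
    λ T mtds _ → k≤∣TDS∣ T (proj₁ mtds)

fromPred : ∀ {n} → (ℕ → Bool) → Subset n
fromPred g = tabulate (g ∘ toℕ)

𝟙-fromPred : ∀ n (g : ℕ → Bool) i → i < n → 𝟙 (fromPred {n} g) i ≡ bit (g i)
𝟙-fromPred (suc n) g zero    _       = refl
𝟙-fromPred (suc n) g (suc i) 1+i<1+n = 𝟙-fromPred n (g ∘ suc) i (≤-pred 1+i<1+n)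

∣fromPred∣ : ∀ n (g : ℕ → Bool) → ∣ fromPred {n} g ∣ ≡ ∑< n (bit ∘ g)
∣fromPred∣ n g = trans (∣p∣≡∑<𝟙 (fromPred {n} g)) (∑<-cong n (𝟙-fromPred n g))

∈-fromPred : ∀ {n} {g : ℕ → Bool} {x : Fin n} {i} → toℕ x ≡ i → g i ≡ true → x ∈ fromPred g
∈-fromPred {x = zero}  refl gi≡true rewrite gi≡true = here
∈-fromPred {g = g} {x = suc x} refl gi≡true = there (∈-fromPred {g = g ∘ suc} refl gi≡true)

SuccMod⇒≡next : ∀ {n} {i j : Fin n} → SuccMod n i j → toℕ j ≡ next n (toℕ i)
SuccMod⇒≡next {n} {i} {j} (inj₁ i+1≡j) =
  sym (trans (next-nonlast 1+i≢n) (trans (+-comm 1 (toℕ i)) i+1≡j))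
  where
  1+i≢n : ¬ suc (toℕ i) ≡ n
  1+i≢n 1+i≡n = <⇒≢ (toℕ<n j) (trans (sym i+1≡j) (trans (+-comm (toℕ i) 1) 1+i≡n))
SuccMod⇒≡next {n} {i} {j} (inj₂ (i+1≡n , j≡0)) =
  trans j≡0 (sym (next-last (trans (+-comm 1 (toℕ i)) i+1≡n)))

≡next⇒SuccMod : ∀ {n} {i j : Fin n} → toℕ j ≡ next n (toℕ i) → SuccMod n i j
≡next⇒SuccMod {n} {i} {j} j≡next with suc (toℕ i) ≟ n
... | yes 1+i≡n = inj₂ (trans (+-comm (toℕ i) 1) 1+i≡n , j≡next)
... | no  _     = inj₁ (trans (+-comm (toℕ i) 1) (sym j≡next))

CycleAdj⇒≡next⊎≡prev : ∀ {n} {v u : Fin n} → CycleAdj n v u →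
                       toℕ u ≡ next n (toℕ v) ⊎ toℕ u ≡ prev n (toℕ v)
CycleAdj⇒≡next⊎≡prev         (inj₁ v→u) = inj₁ (SuccMod⇒≡next v→u)
CycleAdj⇒≡next⊎≡prev {u = u} (inj₂ u→v) =
  inj₂ (trans (sym (prev-next (toℕ<n u))) (cong (prev _) (sym (SuccMod⇒≡next u→v))))

≡prev⇒CycleAdj : ∀ {n} {v u : Fin n} → toℕ u ≡ prev n (toℕ v) → CycleAdj n v u
≡prev⇒CycleAdj {v = v} u≡prev =
  inj₂ (≡next⇒SuccMod (trans (sym (next-prev (toℕ<n v))) (cong (next _) (sym u≡prev))))

Covering : ℕ → (ℕ → ℕ) → Set
Covering n s = ∀ v → v < n → 1 ≤ s (prev n v) + s (next n v)

IsTDS⇒Covering : ∀ {n} {S : Subset n} → IsTDS (CycleAdj n) S → Covering n (𝟙 S)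
IsTDS⇒Covering {n} {S} tds v v<n with tds (fromℕ< v<n)
... | u , u∈S , v~u with CycleAdj⇒≡next⊎≡prev v~u
... | inj₁ u≡next = ≤-trans (x∈p⇒1≤𝟙 u∈S (trans u≡next (cong (next n) (toℕ-fromℕ< v<n)))) (m≤n+m _ _)
... | inj₂ u≡prev = ≤-trans (x∈p⇒1≤𝟙 u∈S (trans u≡prev (cong (prev n) (toℕ-fromℕ< v<n)))) (m≤m+n _ _)

/2-+4 : ∀ n → (4 + n) / 2 ≡ 2 + n / 2
/2-+4 n = trans (m/n≡1+[m∸n]/n {4 + n} {2} (s≤s (s≤s z≤n)))
                (cong suc (m/n≡1+[m∸n]/n {2 + n} {2} (s≤s (s≤s z≤n))))

-- (4 + n) % 4 reduces to n % 4, so the case split below lines up with the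
-- one in cycleTDDeg.
cycleTDDeg-+4 : ∀ n → cycleTDDeg (4 + n) ≡ 2 + cycleTDDeg n
cycleTDDeg-+4 n with n % 4
... | 0                 = /2-+4 n
... | 1                 = /2-+4 (n + 1)
... | 2                 = cong (_+ 1) (/2-+4 n)
... | suc (suc (suc _)) = /2-+4 (n + 1)

[2+m]+[2+m]≡4+[m+m] : ∀ m → (2 + m) + (2 + m) ≡ 4 + (m + m)
[2+m]+[2+m]≡4+[m+m] = solve-∀

cycleTDDeg-odd : ∀ j → cycleTDDeg (suc (j + j)) ≡ ⌈ suc (j + j) /2⌉
cycleTDDeg-odd 0             = refl
cycleTDDeg-odd 1             = refl
cycleTDDeg-odd (suc (suc j)) = begin
    cycleTDDeg (suc ((2 + j) + (2 + j)))
  ≡⟨ cong (cycleTDDeg ∘ suc) ([2+m]+[2+m]≡4+[m+m] j) ⟩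
    cycleTDDeg (4 + suc (j + j))
  ≡⟨ cycleTDDeg-+4 (suc (j + j)) ⟩
    2 + cycleTDDeg (suc (j + j))
  ≡⟨ cong (2 +_) (cycleTDDeg-odd j) ⟩
    ⌈ 4 + suc (j + j) /2⌉
  ≡⟨ cong (⌈_/2⌉ ∘ suc) ([2+m]+[2+m]≡4+[m+m] j) ⟨
    ⌈ suc ((2 + j) + (2 + j)) /2⌉
  ∎
  where open ≡-Reasoning

cycleTDDeg-even : ∀ m → cycleTDDeg (m + m) ≡ ⌈ m /2⌉ + ⌈ m /2⌉
cycleTDDeg-even 0             = refl
cycleTDDeg-even 1             = refl
cycleTDDeg-even (suc (suc m)) = begin
    cycleTDDeg ((2 + m) + (2 + m))
  ≡⟨ cong cycleTDDeg ([2+m]+[2+m]≡4+[m+m] m) ⟩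
    cycleTDDeg (4 + (m + m))
  ≡⟨ cycleTDDeg-+4 (m + m) ⟩
    2 + cycleTDDeg (m + m)
  ≡⟨ cong (2 +_) (cycleTDDeg-even m) ⟩
    2 + (⌈ m /2⌉ + ⌈ m /2⌉)
  ≡⟨ cong suc (+-suc ⌈ m /2⌉ ⌈ m /2⌉) ⟨
    suc ⌈ m /2⌉ + suc ⌈ m /2⌉
  ∎
  where open ≡-Reasoning

data EvenOdd : ℕ → Set where
  even : ∀ m → EvenOdd (m + m)
  odd  : ∀ m → EvenOdd (suc (m + m))

evenOdd : ∀ n → EvenOdd n
evenOdd zero = even 0
evenOdd (suc n) with evenOdd n
... | even m = odd m
... | odd  m = subst EvenOdd (cong suc (+-suc m m)) (even (suc m))

Covering⇒⌈n/2⌉≤∑ : ∀ {n s} → Covering n s → ⌈ n /2⌉ ≤ ∑< n s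
Covering⇒⌈n/2⌉≤∑ {n} {s} cov = double-counting n s (prev n) (next n) (∑<-prev n s) (∑<-next n s) cov

Covering⇒2⌈m/2⌉≤∑ : ∀ {m s} → Covering (m + m) s → ⌈ m /2⌉ + ⌈ m /2⌉ ≤ ∑< (m + m) s
Covering⇒2⌈m/2⌉≤∑ {m} {s} cov = begin
    ⌈ m /2⌉ + ⌈ m /2⌉
  ≤⟨ +-mono-≤ (double-counting m evens id (next m) refl (∑<-next m evens) evens-covered)
              (double-counting m odds (prev m) id (∑<-prev m odds) refl odds-covered) ⟩
    ∑< m evens + ∑< m odds
  ≡⟨ ∑<-evens+odds m s ⟨
    ∑< (m + m) s
  ∎
  where
  open ≤-Reasoning
  evens odds : ℕ → ℕ
  evens k = s (k + k)
  odds  k = s (suc (k + k))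
  evens-covered : ∀ k → k < m → 1 ≤ evens k + evens (next m k)
  evens-covered k k<m = subst (λ i → 1 ≤ evens k + s i) (next-double-suc k<m)
                              (cov (suc (k + k)) (k<m⇒1+[k+k]<m+m k<m))
  odds-covered : ∀ k → k < m → 1 ≤ odds (prev m k) + odds k
  odds-covered k k<m = subst₂ (λ i j → 1 ≤ s i + s j) (prev-double k<m) (next-double k<m)
                             (cov (k + k) (+-mono-< k<m k<m))

Covering⇒cycleTDDeg≤∑ : ∀ {n s} → Covering n s → cycleTDDeg n ≤ ∑< n s
Covering⇒cycleTDDeg≤∑ {n} {s} cov with evenOdd n
... | even m = subst (_≤ ∑< n s) (sym (cycleTDDeg-even m)) (Covering⇒2⌈m/2⌉≤∑ {m} cov)
... | odd  j = subst (_≤ ∑< n s) (sym (cycleTDDeg-odd j)) (Covering⇒⌈n/2⌉≤∑ cov)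

cycleTDDeg≤∣TDS∣ : ∀ {n} (S : Subset n) → IsTDS (CycleAdj n) S → cycleTDDeg n ≤ ∣ S ∣
cycleTDDeg≤∣TDS∣ {n} S tds =
  subst (cycleTDDeg n ≤_) (sym (∣p∣≡∑<𝟙 S)) (Covering⇒cycleTDDeg≤∑ (IsTDS⇒Covering tds))

Dominating : ℕ → (ℕ → Bool) → Set
Dominating n g = ∀ v → v < n → g (prev n v) ≡ true ⊎ g (next n v) ≡ true

Dominating⇒IsTDS : ∀ {n} {g : ℕ → Bool} → Dominating n g → IsTDS (CycleAdj n) (fromPred g)
Dominating⇒IsTDS {n} {g} dom v with dom (toℕ v) (toℕ<n v)
... | inj₁ g[prev] = fromℕ< (prev< (toℕ<n v)) , ∈-fromPred {g = g} (toℕ-fromℕ< _) g[prev] ,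
                     ≡prev⇒CycleAdj (toℕ-fromℕ< _)
... | inj₂ g[next] = fromℕ< (next< (toℕ<n v)) , ∈-fromPred {g = g} (toℕ-fromℕ< _) g[next] ,
                     inj₁ (≡next⇒SuccMod (toℕ-fromℕ< _))

rotate : ℕ → ℕ → (ℕ → Bool) → ℕ → Bool
rotate n zero    g = g
rotate n (suc k) g = rotate n k g ∘ prev n

rotate-at-shift : ∀ n k (g : ℕ → Bool) → rotate n k g k ≡ g 0
rotate-at-shift n zero    g = refl
rotate-at-shift n (suc k) g = rotate-at-shift n k g

Dominating-∘prev : ∀ {n g} → Dominating n g → Dominating n (g ∘ prev n)
Dominating-∘prev {n} {g} dom v v<n with dom (prev n v) (prev< v<n)
... | inj₁ g[prev²] = inj₁ g[prev²]
... | inj₂ g[v]     = inj₂ (trans (cong g (prev-next v<n))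
                                  (trans (cong g (sym (next-prev v<n))) g[v]))

Dominating-rotate : ∀ {n g} k → Dominating n g → Dominating n (rotate n k g)
Dominating-rotate         zero    dom = dom
Dominating-rotate {n} {g} (suc k) dom = Dominating-∘prev {g = rotate n k g} (Dominating-rotate k dom)

∑<-rotate : ∀ n k (g : ℕ → Bool) → ∑< n (bit ∘ rotate n k g) ≡ ∑< n (bit ∘ g)
∑<-rotate n zero    g = refl
∑<-rotate n (suc k) g = trans (∑<-prev n (bit ∘ rotate n k g)) (∑<-rotate n k g)

twoOnTwoOff : ℕ → Bool
twoOnTwoOff 0                         = true
twoOnTwoOff 1                         = true
twoOnTwoOff 2                         = false
twoOnTwoOff 3                         = false
twoOnTwoOff (suc (suc (suc (suc i)))) = twoOnTwoOff i

twoOnTwoOff-gap : ∀ i → twoOnTwoOff i ≡ true ⊎ twoOnTwoOff (2 + i) ≡ true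
twoOnTwoOff-gap 0                         = inj₁ refl
twoOnTwoOff-gap 1                         = inj₁ refl
twoOnTwoOff-gap 2                         = inj₂ refl
twoOnTwoOff-gap 3                         = inj₂ refl
twoOnTwoOff-gap (suc (suc (suc (suc i)))) = twoOnTwoOff-gap i

-- Matching on the test made by next also evaluates next in the goal.
Dominating-twoOnTwoOff : ∀ n → Dominating n twoOnTwoOff
Dominating-twoOnTwoOff n zero _ with 1 ≟ n
... | yes refl = inj₁ refl
... | no  _    = inj₂ refl
Dominating-twoOnTwoOff n (suc i) _ with 2 + i ≟ n
... | yes _ = inj₂ refl
... | no  _ = twoOnTwoOff-gap i

∑<-twoOnTwoOff : ∀ n → ∑< n (bit ∘ twoOnTwoOff) ≡ cycleTDDeg n
∑<-twoOnTwoOff 0                         = refl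
∑<-twoOnTwoOff 1                         = refl
∑<-twoOnTwoOff 2                         = refl
∑<-twoOnTwoOff 3                         = refl
∑<-twoOnTwoOff (suc (suc (suc (suc n)))) = begin
    ∑< (4 + n) (bit ∘ twoOnTwoOff)
  ≡⟨ ∑<-+ 4 n (bit ∘ twoOnTwoOff) ⟩
    2 + ∑< n (bit ∘ twoOnTwoOff)
  ≡⟨ cong (2 +_) (∑<-twoOnTwoOff n) ⟩
    2 + cycleTDDeg n
  ≡⟨ cycleTDDeg-+4 n ⟨
    cycleTDDeg (4 + n)
  ∎
  where open ≡-Reasoning

cycle-minimum-TDS∋ : ∀ {n} (a : Fin n) →
                     ∃ λ S → IsTDS (CycleAdj n) S × a ∈ S × ∣ S ∣ ≡ cycleTDDeg n
cycle-minimum-TDS∋ {n} a =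
  fromPred g ,
  Dominating⇒IsTDS {g = g} (Dominating-rotate {g = twoOnTwoOff} (toℕ a) (Dominating-twoOnTwoOff n)) ,
  ∈-fromPred {g = g} refl (rotate-at-shift n (toℕ a) twoOnTwoOff) ,
  trans (∣fromPred∣ n g) (trans (∑<-rotate n (toℕ a) twoOnTwoOff) (∑<-twoOnTwoOff n))
  where
  g : ℕ → Bool
  g = rotate n (toℕ a) twoOnTwoOff

theorem5 : (n : ℕ) → 3 ≤ n →
    CompliantGraph (CycleAdj n) × ((a : Fin n) → TotalDomDegree (CycleAdj n) a (cycleTDDeg n))
theorem5 n _ = (λ a → compliant (degree a)) , degree
  where
  degree : (a : Fin n) → TotalDomDegree (CycleAdj n) a (cycleTDDeg n)
  degree a = minimum-TDS∋⇒TotalDomDegree (CycleAdj n) (cycleTDDeg n) cycleTDDeg≤∣TDS∣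
                                         (cycle-minimum-TDS∋ a)
  compliant : ∀ {a} → TotalDomDegree (CycleAdj n) a (cycleTDDeg n) → Compliant (CycleAdj n) a
  compliant ((S , mtds , a∈S , _) , _) = S , mtds , a∈S
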